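{- Let $G$ be a reduced graph with start $s$ and finish $t$, and let $\delta$ be the degree of a vertex of $G$ that is not a cut-vertex. Then every tracking set for $(s,t)$ in $G$ has size at least $\delta-2$.
   Context: All graphs are finite, undirected and simple; paths do not repeat vertices. Given $G=(V,E)$ and $s,t\in V$, a tracking set for $(s,t)$ is a set $T\subseteq V$ such that for any two distinct $s$-$t$ paths $P,Q$, the sequences of vertices of $T$ traversed (in order) by $P$ and $Q$ differ. Reduction rules: Rule 1: if some edge or vertex lies on no $s$-$t$ path, remove it. Rule 2: if $\deg(s)=1$ and $N(s)\neq\{t\}$, remove $s$ and relabel its neighbor as $s$ (symmetrically for $t$). Rule 3: if there are adjacent vertices $a,b\notin\{s,t\}$ with $\deg(a)=\deg(b)=2$, contract the edge $ab$. A graph is reduced if none of Rules 1, 2, 3 applies. It is assumed that the reduced graph is not the single edge $st$, so all its vertices have degree at least 2. -}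

module Defs where

open import Data.Nat using (ℕ; suc; zero)
open import Data.Bool using (Bool; true; false; T)
open import Data.Fin using (Fin)
open import Data.List using (List; []; _∷_; [_]; _++_; length; filter; allFin)
open import Data.List.Relation.Unary.Unique.Propositional using (Unique)
open import Data.Product using (Σ; ∃; _×_; _,_)
open import Data.Sum using (_⊎_)
open import Data.Empty using (⊥)
open import Relation.Nullary using (¬_)
open import Relation.Nullary.Decidable using (Dec; yes; no)
open import Relation.Binary.PropositionalEquality using (_≡_; _≢_)
open import Function.Bundles using (_⇔_)
open import Data.Fin.Subset using (Subset)
open import Data.Vec using (lookup)

record Graph (n : ℕ) : Set where
  field
    adj   : Fin n → Fin n → Bool
    sym   : ∀ u v → adj u v ≡ adj v u
    irrefl : ∀ v → adj v v ≡ false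

module _ {n : ℕ} (G : Graph n) where
  open Graph G

  Edge : Fin n → Fin n → Set
  Edge u v = T (adj u v)

  neighbours : Fin n → List (Fin n)
  neighbours v = filter (λ u → T? (adj v u)) (allFin n)
    where
    T? : (b : Bool) → Dec (T b)
    T? true = yes _
    T? false = no (λ ())

  degree : Fin n → ℕ
  degree v = length (neighbours v)

  data Walk : Fin n → Fin n → List (Fin n) → Set where
    here : ∀ {u} → Walk u u [ u ]
    step : ∀ {u v w xs} → Edge u v → Walk v w xs → Walk u w (u ∷ xs)

  Path : Fin n → Fin n → List (Fin n) → Set
  Path u w xs = Walk u w xs × Unique xs

  EdgeOn : Fin n → Fin n → List (Fin n) → Set
  EdgeOn u v xs = ∃ λ pre → ∃ λ post →
    (xs ≡ pre ++ u ∷ v ∷ post) ⊎ (xs ≡ pre ++ v ∷ u ∷ post)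

  Rule1Applies : Fin n → Fin n → Set
  Rule1Applies s t =
    (∃ λ v → ∀ xs → Path s t xs → ¬ (v ∈L xs)) ⊎
    (∃ λ u → ∃ λ v → Edge u v × (∀ xs → Path s t xs → ¬ EdgeOn u v xs))
    where
    _∈L_ : Fin n → List (Fin n) → Set
    v ∈L xs = ∃ λ pre → ∃ λ post → xs ≡ pre ++ v ∷ post

  Rule2AppliesAt : Fin n → Fin n → Set
  Rule2AppliesAt x y = (degree x ≡ 1) × ¬ (∀ u → Edge x u ⇔ (u ≡ y))

  Rule2Applies : Fin n → Fin n → Set
  Rule2Applies s t = Rule2AppliesAt s t ⊎ Rule2AppliesAt t s

  Rule3Applies : Fin n → Fin n → Set
  Rule3Applies s t = ∃ λ a → ∃ λ b → Edge a b ×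
    a ≢ s × a ≢ t × b ≢ s × b ≢ t × degree a ≡ 2 × degree b ≡ 2

  Reduced : Fin n → Fin n → Set
  Reduced s t = ¬ Rule1Applies s t × ¬ Rule2Applies s t × ¬ Rule3Applies s t

  SingleEdge : Fin n → Fin n → Set
  SingleEdge s t = Edge s t × (∀ v → (v ≡ s) ⊎ (v ≡ t))

  data ReachAvoid (x : Fin n) : Fin n → Fin n → Set where
    rrefl : ∀ {u} → u ≢ x → ReachAvoid x u u
    rstep : ∀ {u v w} → u ≢ x → Edge u v → ReachAvoid x v w → ReachAvoid x u w

  Connected : Fin n → Fin n → Set
  Connected u w = ∃ λ xs → Walk u w xs

  -- cut-vertex: its removal increases the number of connected components,
  -- i.e. two other vertices connected in G become disconnected in G - x
  CutVertex : Fin n → Set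
  CutVertex x = ∃ λ u → ∃ λ w → u ≢ x × w ≢ x ×
    Connected u w × ¬ ReachAvoid x u w

  trace : Subset n → List (Fin n) → List (Fin n)
  trace S [] = []
  trace S (v ∷ xs) with lookup S v
  ... | true = v ∷ trace S xs
  ... | false = trace S xs

  TrackingSet : Fin n → Fin n → Subset n → Set
  TrackingSet s t S = ∀ xs ys → Path s t xs → Path s t ys → xs ≢ ys →
    trace S xs ≢ trace S ys

-- Since G is reduced, v lies on an s–t path A v B, and since v is not a cut-vertex,
-- every neighbour of v reaches that path in G − v. Grow a forest in G − v with two
-- trees, rooted at s and at t, containing A and B respectively and spanning N(v);
-- the route of u (its tree path to the root) is consistent: the route of a vertex on
-- it is a suffix of it. For a neighbour c in the tree of s, the walk t B⁻¹ v followed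
-- by the route of c is a t–s path, and symmetrically for the tree of t. Distinct
-- neighbours in one tree give distinct paths, so their routes have distinct traces.
-- By consistency the trace of a route is determined by its first tracked vertex, so
-- c ↦ (first tracked vertex on the route of c, or the tree of c if there is none)
-- is injective on N(v) with values in T ⊎ {s, t}, whence deg v ≤ |T| + 2.

module Submission where

open import Defs
open import Level using (Level)
open import Data.Nat using (_≤_; _∸_; _+_; _≤?_; z≤n)
open import Data.Nat.Properties
  using (≤-<-trans; +-monoˡ-<; +-monoʳ-<; m≤n+o⇒m∸n≤o; module ≤-Reasoning)
open import Data.Fin using (Fin; zero; suc; _≟_)
open import Data.Fin.Subset using (Subset; ∣_∣; _-_) renaming (_∈_ to _∈ₛ_; ⊤ to ⊤ₛ)
open import Data.Fin.Subset.Properties using (∈⊤; x∈p⇒∣p-x∣<∣p∣; x∈p∧x≢y⇒x∈p-y)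
open import Data.Bool using (Bool; true; false; T; not)
open import Data.Bool.Properties using (not-¬)
open import Data.Maybe using (Maybe; just; nothing; maybe)
open import Data.Maybe.Properties using (just-injective)
open import Data.List using (List; []; _∷_; [_]; _++_; _∷ʳ_; reverse; length; map; allFin)
open import Data.List.Properties
  using (length-map; reverse-++; unfold-reverse; reverse-injective; ++-cancelˡ; ++-conicalʳ; ++-identityʳ;
         ∷-injectiveˡ; ∷-injectiveʳ)
open import Data.List.Membership.Propositional using (_∈_; _∉_)
open import Data.List.Membership.Propositional.Properties using (∈-filter⁻; ∈-++⁺ʳ; ∈-++⁻)
open import Data.List.Relation.Unary.All using (All; []; _∷_)
import Data.List.Relation.Unary.All as All
import Data.List.Relation.Unary.All.Properties as All
open import Data.List.Relation.Unary.Any using (here; there)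
import Data.List.Relation.Unary.Any.Properties as Any
open import Data.List.Relation.Unary.Unique.Propositional using (Unique)
import Data.List.Relation.Unary.Unique.Propositional.Properties as Unique
open import Data.List.Relation.Unary.AllPairs using ([]; _∷_)
open import Data.List.Relation.Binary.Disjoint.Propositional using (Disjoint)
open import Data.List.Relation.Binary.Permutation.Propositional using (↭-sym; ↭⇒↭ₛ)
open import Data.List.Relation.Binary.Permutation.Propositional.Properties using (↭-reverse; All-resp-↭)
open import Data.List.Relation.Binary.Permutation.Setoid.Properties using (Unique-resp-↭)
open import Data.Product using (Σ; ∃; ∃₂; _×_; _,_; proj₁; proj₂; map₁; map₂)
open import Data.Sum using (_⊎_; inj₁; inj₂; [_,_]′)
open import Data.Sum.Properties using (inj₁-injective)
open import Data.Unit using (⊤; tt)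
open import Data.Vec using (lookup)
open import Data.Vec.Properties using (lookup⇒[]=)
open import Data.Vec.Functional using (updateAt)
open import Data.Vec.Functional.Properties using (updateAt-updates; updateAt-minimal)
open import Function using (_∘_; id; const)
open import Relation.Nullary using (¬_; yes; no)
open import Relation.Nullary.Decidable using (decidable-stable)
open import Relation.Nullary.Negation using (¬¬-Monad; contradiction)
open import Relation.Binary.PropositionalEquality
  using (_≡_; _≢_; refl; sym; trans; cong; subst; ≢-sym; setoid; module ≡-Reasoning)

private
  variable
    a p : Level
    A B : Set a

module _ {A : Set a} where

  unique-reverse : ∀ {xs : List A} → Unique xs → Unique (reverse xs)
  unique-reverse {xs} = Unique-resp-↭ (setoid A) (↭⇒↭ₛ (↭-sym (↭-reverse xs)))

  all-reverse : ∀ {P : A → Set p} {xs} → All P xs → All P (reverse xs)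
  all-reverse {xs = xs} = All-resp-↭ (↭-sym (↭-reverse xs))

  unique-++⁻ : ∀ xs {ys : List A} → Unique (xs ++ ys) → Unique xs × Unique ys × Disjoint xs ys
  unique-++⁻ [] u = [] , u , λ ()
  unique-++⁻ (x ∷ xs) (x∉ ∷ u) with unique-++⁻ xs u
  ... | uxs , uys , disjoint = All.++⁻ˡ xs x∉ ∷ uxs , uys , λ where
    (here refl , y∈ys) → All.lookup (All.++⁻ʳ xs x∉) y∈ys refl
    (there y∈xs , y∈ys) → disjoint (y∈xs , y∈ys)

  unique-map⁺ : ∀ {P : A → Set p} {f : A → B} {xs} →
                (∀ {x y} → P x → P y → x ≢ y → f x ≢ f y) → All P xs → Unique xs → Unique (map f xs)
  unique-map⁺ inj [] [] = []
  unique-map⁺ inj (px ∷ pxs) (x∉ ∷ u) =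
    All.map⁺ (All.zipWith (λ (py , x≢y) → inj px py x≢y) (pxs , x∉)) ∷ unique-map⁺ inj pxs u

length≤∣p∣+∣q∣ : ∀ {m k} {p : Subset m} {q : Subset k} (xs : List (Fin m ⊎ Fin k)) →
                 Unique xs → All [ _∈ₛ p , _∈ₛ q ]′ xs → length xs ≤ ∣ p ∣ + ∣ q ∣
length≤∣p∣+∣q∣ [] _ _ = z≤n
length≤∣p∣+∣q∣ {p = p} {q} (inj₁ i ∷ xs) (i∉ ∷ u) (i∈p ∷ inside) =
  ≤-<-trans (length≤∣p∣+∣q∣ xs u (All.zipWith remove (i∉ , inside)))
            (+-monoˡ-< ∣ q ∣ (x∈p⇒∣p-x∣<∣p∣ i∈p))
  where
  remove : ∀ {x} → inj₁ i ≢ x × [ _∈ₛ p , _∈ₛ q ]′ x → [ _∈ₛ p - i , _∈ₛ q ]′ x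
  remove {inj₁ j} (i≢j , j∈p) = x∈p∧x≢y⇒x∈p-y j∈p (i≢j ∘ cong inj₁ ∘ sym)
  remove {inj₂ j} (_ , j∈q) = j∈q
length≤∣p∣+∣q∣ {p = p} {q} (inj₂ j ∷ xs) (j∉ ∷ u) (j∈q ∷ inside) =
  ≤-<-trans (length≤∣p∣+∣q∣ xs u (All.zipWith remove (j∉ , inside)))
            (+-monoʳ-< ∣ p ∣ (x∈p⇒∣p-x∣<∣p∣ j∈q))
  where
  remove : ∀ {x} → inj₂ j ≢ x × [ _∈ₛ p , _∈ₛ q ]′ x → [ _∈ₛ p , _∈ₛ q - j ]′ x
  remove {inj₁ i} (_ , i∈p) = i∈p
  remove {inj₂ i} (j≢i , i∈q) = x∈p∧x≢y⇒x∈p-y i∈q (j≢i ∘ cong inj₂ ∘ sym)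

module _ {n} (G : Graph n) where
  open Graph G using (irrefl) renaming (sym to adj-sym)

  private
    variable
      u w x : Fin n
      xs : List (Fin n)

  edge-sym : Edge G u w → Edge G w u
  edge-sym {u} {w} = subst T (adj-sym u w)

  edge-irrefl : ¬ Edge G u u
  edge-irrefl {u} = subst T (irrefl u)

  neighbour-edge : w ∈ neighbours G u → Edge G u w
  neighbour-edge {u = u} w∈ = proj₂ (∈-filter⁻ _ {xs = allFin n} w∈)

  walk-head : Walk G u w xs → ∃ λ ys → xs ≡ u ∷ ys
  walk-head here = [] , refl
  walk-head (step _ _) = _ , refl

  walk-first : Walk G u w xs → u ∈ xs
  walk-first here = here refl
  walk-first (step _ _) = here refl

  walk-last : Walk G u w xs → w ∈ xs
  walk-last here = here refl
  walk-last (step _ W) = there (walk-last W)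

  walk-++ : ∀ {z ys} → Walk G u w xs → Walk G w z (w ∷ ys) → Walk G u z (xs ++ ys)
  walk-++ here W′ = W′
  walk-++ (step e W) W′ = step e (walk-++ W W′)

  walk-∷ʳ : Walk G u w xs → Edge G w x → Walk G u x (xs ∷ʳ x)
  walk-∷ʳ here e = step e here
  walk-∷ʳ (step e′ W) e = step e′ (walk-∷ʳ W e)

  walk-reverse : Walk G u w xs → Walk G w u (reverse xs)
  walk-reverse here = here
  walk-reverse (step {u} {xs = xs} e W) =
    subst (Walk G _ u) (sym (unfold-reverse u xs)) (walk-∷ʳ (walk-reverse W) (edge-sym e))

  walk-split : ∀ A {B} → Walk G u w xs → xs ≡ A ++ x ∷ B →
               Walk G u x (A ∷ʳ x) × Walk G x w (x ∷ B)
  walk-split [] here refl = here , here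
  walk-split [] (step e W) refl = here , step e W
  walk-split (_ ∷ A) {B} here eq with () ← ++-conicalʳ A (_ ∷ B) (sym (∷-injectiveʳ eq))
  walk-split (_ ∷ A) (step e W) refl = map₁ (step e) (walk-split A W refl)

  reach-avoid-end : ReachAvoid G x u w → w ≢ x
  reach-avoid-end (rrefl u≢x) = u≢x
  reach-avoid-end (rstep _ _ R) = reach-avoid-end R

  reach-avoid⇒walk : ReachAvoid G x u w → ∃ λ xs → Walk G u w xs × All (_≢ x) xs
  reach-avoid⇒walk (rrefl u≢x) = _ , here , u≢x ∷ []
  reach-avoid⇒walk (rstep u≢x e R) =
    let xs , W , avoid = reach-avoid⇒walk R in _ , step e W , u≢x ∷ avoid

  module _ (S : Subset n) where

    trace-inside : lookup S x ≡ true → trace G S (x ∷ xs) ≡ x ∷ trace G S xs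
    trace-inside {x} x∈S with lookup S x
    ... | true = refl

    trace-++ : ∀ xs ys → trace G S (xs ++ ys) ≡ trace G S xs ++ trace G S ys
    trace-++ [] ys = refl
    trace-++ (x ∷ xs) ys with lookup S x
    ... | true = cong (x ∷_) (trace-++ xs ys)
    ... | false = trace-++ xs ys

    trace-reverse : ∀ xs → trace G S (reverse xs) ≡ reverse (trace G S xs)
    trace-reverse [] = refl
    trace-reverse (x ∷ xs) = begin
      trace G S (reverse (x ∷ xs))                  ≡⟨ cong (trace G S) (unfold-reverse x xs) ⟩
      trace G S (reverse xs ∷ʳ x)                   ≡⟨ trace-++ (reverse xs) [ x ] ⟩
      trace G S (reverse xs) ++ trace G S [ x ]     ≡⟨ cong (_++ trace G S [ x ]) (trace-reverse xs) ⟩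
      reverse (trace G S xs) ++ trace G S [ x ]     ≡⟨ last-step ⟩
      reverse (trace G S (x ∷ xs))                  ∎
      where
      open ≡-Reasoning
      last-step : reverse (trace G S xs) ++ trace G S [ x ] ≡ reverse (trace G S (x ∷ xs))
      last-step with lookup S x in x∈?S
      ... | true = sym (unfold-reverse x (trace G S xs))
      ... | false = ++-identityʳ _

    trace-first : ∀ xs {w ws} → trace G S xs ≡ w ∷ ws → lookup S w ≡ true ×
                  ∃₂ λ pre post → xs ≡ pre ++ w ∷ post × trace G S xs ≡ trace G S (w ∷ post)
    trace-first (x ∷ xs) eq with lookup S x in x∈?S
    ... | true with refl ← eq = x∈?S , [] , xs , refl , sym (trace-inside x∈?S)
    ... | false with w∈S , pre , post , refl , same ← trace-first xs eq =
      w∈S , x ∷ pre , post , refl , same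

  tracking-reverse : ∀ {s t S} → TrackingSet G s t S → TrackingSet G t s S
  tracking-reverse {S = S} track xs ys (Wx , Ux) (Wy , Uy) xs≢ys same =
    track (reverse xs) (reverse ys) (walk-reverse Wx , unique-reverse Ux) (walk-reverse Wy , unique-reverse Uy)
          (xs≢ys ∘ reverse-injective)
          (trans (trace-reverse S xs) (trans (cong reverse same) (sym (trace-reverse S ys))))

module Forests {n} (G : Graph n) (v s t : Fin n) where

  private
    variable
      b b′ : Bool
      u w : Fin n
      xs : List (Fin n)

  root : Bool → Fin n
  root true = s
  root false = t

  SuffixClosed : (Fin n → List (Fin n)) → List (Fin n) → Set
  SuffixClosed route [] = ⊤
  SuffixClosed route (w ∷ ws) = route w ≡ w ∷ ws × SuffixClosed route ws

  InTree : (Fin n → Maybe Bool) → (Fin n → List (Fin n)) → Bool → List (Fin n) → Set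
  InTree label route b xs = Unique xs × All (λ w → label w ≡ just b) xs × SuffixClosed route xs

  IsRoute : (Fin n → Maybe Bool) → (Fin n → List (Fin n)) → Bool → Fin n → List (Fin n) → Set
  IsRoute label route b u xs = Walk G u (root b) xs × InTree label route b xs

  -- label u ≡ just b puts u in the tree rooted at root b; route u is its path to that root.
  record Forest : Set where
    field
      label : Fin n → Maybe Bool
      route : Fin n → List (Fin n)
      v-unlabelled : label v ≡ nothing
      route-valid : label u ≡ just b → IsRoute label route b u (route u)

  open Forest

  Side : Forest → Bool → Fin n → Set
  Side F b u = label F u ≡ just b

  Labelled : Forest → Fin n → Set
  Labelled F u = ∃ λ b → Side F b u

  _⊑_ : Forest → Forest → Set
  F ⊑ F′ = ∀ {u b} → Side F b u → Side F′ b u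

  suffix-route : ∀ {route} pre {post} → SuffixClosed route (pre ++ w ∷ post) → route w ≡ w ∷ post
  suffix-route [] (eq , _) = eq
  suffix-route (_ ∷ pre) (_ , closed) = suffix-route pre closed

  module Graft (F : Forest) {u b τ} (u-unlabelled : label F u ≡ nothing) (u≢v : u ≢ v)
               (walk : Walk G u (root b) (u ∷ τ)) (τ-in-tree : InTree (label F) (route F) b τ) where

    label′ : Fin n → Maybe Bool
    label′ = updateAt (label F) u (const (just b))

    route′ : Fin n → List (Fin n)
    route′ = updateAt (route F) u (const (u ∷ τ))

    label′-grafted : label′ u ≡ just b
    label′-grafted = updateAt-updates u (label F)

    label′-other : w ≢ u → label′ w ≡ label F w
    label′-other w≢u = updateAt-minimal _ _ (label F) w≢u

    labelled≢grafted : label F w ≡ just b′ → w ≢ u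
    labelled≢grafted lw refl with () ← trans (sym u-unlabelled) lw

    route′-other : w ≢ u → route′ w ≡ route F w
    route′-other w≢u = updateAt-minimal _ _ (route F) w≢u

    extends : label F w ≡ just b′ → label′ w ≡ just b′
    extends lw = trans (label′-other (labelled≢grafted lw)) lw

    closed′ : All (λ w → label F w ≡ just b′) xs → SuffixClosed (route F) xs → SuffixClosed route′ xs
    closed′ [] _ = tt
    closed′ (lw ∷ lws) (rw , closed) =
      trans (route′-other (labelled≢grafted lw)) rw , closed′ lws closed

    in-tree′ : InTree (label F) (route F) b′ xs → InTree label′ route′ b′ xs
    in-tree′ (unique , labelled , closed) = unique , All.map extends labelled , closed′ labelled closed

    grafted-in-tree : InTree label′ route′ b (u ∷ τ)
    grafted-in-tree =
      let unique , labelled , closed = τ-in-tree in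
      (All.map (≢-sym ∘ labelled≢grafted) labelled ∷ unique) ,
      (label′-grafted ∷ All.map extends labelled) ,
      (updateAt-updates u (route F) , closed′ labelled closed)

    forest : Forest
    forest = record
      { label = label′
      ; route = route′
      ; v-unlabelled = trans (label′-other (u≢v ∘ sym)) (v-unlabelled F)
      ; route-valid = valid
      }
      where
      valid : ∀ {w b′} → label′ w ≡ just b′ → IsRoute label′ route′ b′ w (route′ w)
      valid {w} {b′} lw with w ≟ u
      ... | yes refl with refl ← trans (sym lw) label′-grafted =
        subst (IsRoute label′ route′ b u) (sym (updateAt-updates u (route F))) (walk , grafted-in-tree)
      ... | no w≢u =
        let W , in-tree = route-valid F (trans (sym (label′-other w≢u)) lw) in
        subst (IsRoute label′ route′ b′ w) (sym (route′-other w≢u)) (W , in-tree′ in-tree)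

  empty : Forest
  empty = record { label = const nothing ; route = const [] ; v-unlabelled = refl ; route-valid = λ () }

  graft-path : ∀ F {x b} C → Walk G x (root b) (x ∷ C) → Unique C → All (_≢ v) C →
               All (λ u → label F u ≡ nothing) C →
               Σ Forest λ F′ → InTree (label F′) (route F′) b C × (∀ {u} → u ∉ C → label F′ u ≡ label F u)
  graft-path F [] _ _ _ _ = F , ([] , [] , tt) , λ _ → refl
  graft-path F (c ∷ C) (step _ W) (c∉C ∷ unique) (c≢v ∷ avoid) (c-unlabelled ∷ unlabelled)
    with refl ← ∷-injectiveˡ (proj₂ (walk-head G W)) =
    let F₁ , C-in-tree , unchanged = graft-path F C W unique avoid unlabelled
        c-unlabelled₁ = trans (unchanged (λ c∈C → All.lookup c∉C c∈C refl)) c-unlabelled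
        open Graft F₁ c-unlabelled₁ c≢v W C-in-tree
    in forest , grafted-in-tree , λ u∉ → trans (label′-other (u∉ ∘ here)) (unchanged (u∉ ∘ there))

  grow : ∀ F {c w xs} → Walk G c w xs → All (_≢ v) xs → Labelled F w →
         Σ Forest λ F′ → F ⊑ F′ × Labelled F′ c
  grow F here _ lw = F , id , lw
  grow F {c} (step e W) (c≢v ∷ avoid) lw with grow F W avoid lw
  ... | F₁ , F⊑F₁ , (b , l-next) with label F₁ c in lc
  ...   | just b′ = F₁ , F⊑F₁ , b′ , lc
  ...   | nothing =
    let W′ , in-tree = route-valid F₁ l-next
        open Graft F₁ lc c≢v (step e W′) in-tree
    in forest , (λ l → extends (F⊑F₁ l)) , b , label′-grafted

  grow-all : ∀ F {cs} → All (λ c → ∃ λ r → Labelled F r × ReachAvoid G v c r) cs →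
             Σ Forest λ F′ → F ⊑ F′ × All (Labelled F′) cs
  grow-all F [] = F , id , []
  grow-all F ((r , lr , c⇝r) ∷ rest) =
    let xs , W , avoid = reach-avoid⇒walk G c⇝r
        F₁ , F⊑F₁ , lc = grow F W avoid lr
        F₂ , F₁⊑F₂ , lcs = grow-all F₁ (All.map (map₂ (map₁ (map₂ F⊑F₁))) rest)
    in F₂ , (λ l → F₁⊑F₂ (F⊑F₁ l)) , map₂ F₁⊑F₂ lc ∷ lcs

  path-forest : ∀ A {B} → Walk G s t (A ++ v ∷ B) → Unique (A ++ v ∷ B) →
                Σ Forest λ F → All (Side F true) A × All (Side F false) B
  path-forest A {B} W U with U-A , v∉B ∷ U-B , disjoint ← unique-++⁻ A U =
    let W-sv , W-vt = walk-split G A W refl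
        W-vs = subst (Walk G v s) (reverse-++ A [ v ]) (walk-reverse G W-sv)
        F₁ , (_ , A-true , _) , unchanged₁ =
          graft-path empty (reverse A) W-vs (unique-reverse U-A)
            (all-reverse (All.tabulate λ u∈A u≡v → disjoint (subst (_∈ A) u≡v u∈A , here refl)))
            (All.tabulate λ _ → refl)
        F₂ , (_ , B-false , _) , unchanged₂ =
          graft-path F₁ B W-vt U-B (All.map ≢-sym v∉B)
            (All.tabulate λ u∈B → unchanged₁ λ u∈A → disjoint (Any.reverse⁻ u∈A , there u∈B))
    in F₂ , All.tabulate (λ u∈A → trans (unchanged₂ λ u∈B → disjoint (u∈A , there u∈B))
                                         (All.lookup A-true (Any.reverse⁺ u∈A))) , B-false

  Prefix : Forest → Bool → Set
  Prefix F b = ∃ λ pw → Path G (root (not b)) v pw × All (λ u → ¬ Side F b u) pw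

  side-unique : ∀ F → Side F b u → ¬ Side F (not b) u
  side-unique F lu lu′ = not-¬ refl (just-injective (trans (sym lu) lu′))

  v-not-labelled : ∀ F → ¬ Side F b v
  v-not-labelled F lv with () ← trans (sym (v-unlabelled F)) lv

  path-prefix : ∀ A {B} → Walk G s t (A ++ v ∷ B) → Unique (A ++ v ∷ B) →
                ∀ F → All (Side F true) A → All (Side F false) B → ∀ b → Prefix F b
  path-prefix A W U F A-true B-false false =
    let W-sv , _ = walk-split G A W refl
        U-A , _ , disjoint = unique-++⁻ A U
    in A ∷ʳ v ,
       (W-sv , Unique.++⁺ U-A ([] ∷ []) λ where (x∈A , here refl) → disjoint (x∈A , here refl)) ,
       All.++⁺ (All.map (side-unique F) A-true) (v-not-labelled F ∷ [])
  path-prefix A {B} W U F A-true B-false true =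
    let _ , W-vt = walk-split G A W refl
        _ , U-vB , _ = unique-++⁻ A U
    in reverse (v ∷ B) , (walk-reverse G W-vt , unique-reverse U-vB) ,
       all-reverse (v-not-labelled F ∷ All.map (side-unique F) B-false)

  module Counting (S : Subset n) (F : Forest) (track : TrackingSet G s t S)
                  (neighbours-labelled : All (Labelled F) (neighbours G v))
                  (prefix : ∀ b → Prefix F b) where

    track-between : ∀ b → TrackingSet G (root (not b)) (root b) S
    track-between true = tracking-reverse G track
    track-between false = track

    trace-route-first : ∀ {c ws} → Side F b c → trace G S (route F c) ≡ w ∷ ws →
                        lookup S w ≡ true × Side F b w ×
                        trace G S (route F c) ≡ trace G S (route F w)
    trace-route-first {c = c} lc eq with route F c | route-valid F lc | trace-first G S (route F c) eq
    ... | _ | _ , _ , labelled , closed | w∈S , pre , post , refl , same =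
      w∈S , All.lookup labelled (∈-++⁺ʳ pre (here refl)) ,
      trans same (cong (trace G S) (sym (suffix-route pre closed)))

    distinct-traces : ∀ {c c′} → Side F b c → Side F b c′ → Edge G v c → Edge G v c′ →
                      c ≢ c′ → trace G S (route F c) ≢ trace G S (route F c′)
    distinct-traces {b} {c} {c′} lc lc′ e e′ c≢c′ same =
      track-between b (pw ++ route F c) (pw ++ route F c′) (through lc e) (through lc′ e′)
        (c≢c′ ∘ same-start lc lc′ ∘ ++-cancelˡ pw _ _)
        (trans (trace-++ G S pw _) (trans (cong (trace G S pw ++_) same) (sym (trace-++ G S pw _))))
      where
      pw : List (Fin n)
      pw = proj₁ (prefix b)

      through : ∀ {c} → Side F b c → Edge G v c →
                Path G (root (not b)) (root b) (pw ++ route F c)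
      through lc e =
        let W , U , labelled , _ = route-valid F lc
            (W-pw , U-pw) , avoid = proj₂ (prefix b)
        in walk-++ G W-pw (step e W) ,
           Unique.++⁺ U-pw U λ (x∈pw , x∈route) → All.lookup avoid x∈pw (All.lookup labelled x∈route)

      same-start : ∀ {c c′} → Side F b c → Side F b c′ → route F c ≡ route F c′ → c ≡ c′
      same-start lc lc′ eq =
        let _ , rc = walk-head G (proj₁ (route-valid F lc))
            _ , rc′ = walk-head G (proj₁ (route-valid F lc′))
        in ∷-injectiveˡ (trans (sym rc) (trans eq rc′))

    side : Bool → Fin 2
    side true = zero
    side false = suc zero

    side-injective : side b ≡ side b′ → b ≡ b′
    side-injective {true} {true} _ = refl
    side-injective {false} {false} _ = refl

    key-from : Bool → List (Fin n) → Fin 2 ⊎ Fin n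
    key-from b [] = inj₁ (side b)
    key-from b (w ∷ _) = inj₂ w

    -- Unlabelled vertices get the junk key inj₁ zero; only neighbours of v matter.
    key : Fin n → Fin 2 ⊎ Fin n
    key c = maybe (λ b → key-from b (trace G S (route F c))) (inj₁ zero) (label F c)

    key-labelled : ∀ {c} → Side F b c → key c ≡ key-from b (trace G S (route F c))
    key-labelled {c = c} = cong (maybe (λ b → key-from b (trace G S (route F c))) (inj₁ zero))

    key-injective : ∀ {c c′} → Side F b c → Side F b′ c′ → key c ≡ key c′ →
                    b ≡ b′ × trace G S (route F c) ≡ trace G S (route F c′)
    key-injective {c = c} {c′} lc lc′ eq
      with trace G S (route F c) in tc | trace G S (route F c′) in tc′
         | trans (sym (key-labelled lc)) (trans eq (key-labelled lc′))
    ... | [] | [] | same-side = side-injective (inj₁-injective same-side) , refl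
    ... | w ∷ _ | _ ∷ _ | refl =
      let _ , lw , same = trace-route-first lc tc
          _ , lw′ , same′ = trace-route-first lc′ tc′
      in just-injective (trans (sym lw) lw′) , trans (sym tc) (trans same (trans (sym same′) tc′))

    key-in-range : ∀ {c} → Side F b c → [ _∈ₛ ⊤ₛ , _∈ₛ S ]′ (key c)
    key-in-range {c = c} lc rewrite key-labelled lc with trace G S (route F c) in tc
    ... | [] = ∈⊤
    ... | w ∷ _ = lookup⇒[]= w S (proj₁ (trace-route-first lc tc))

    keys-unique : Unique (map key (neighbours G v))
    keys-unique =
      unique-map⁺ separated (All.zip (neighbours-labelled , All.tabulate (neighbour-edge G)))
        (Unique.filter⁺ _ (Unique.allFin⁺ n))
      where
      separated : ∀ {c c′} → Labelled F c × Edge G v c → Labelled F c′ × Edge G v c′ →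
                  c ≢ c′ → key c ≢ key c′
      separated ((_ , lc) , e) ((_ , lc′) , e′) c≢c′ eq with refl , same ← key-injective lc lc′ eq =
        distinct-traces lc lc′ e e′ c≢c′ same

    degree-bound : degree G v ∸ 2 ≤ ∣ S ∣
    degree-bound = m≤n+o⇒m∸n≤o (degree G v) 2 (begin
      degree G v                        ≡⟨ length-map key (neighbours G v) ⟨
      length (map key (neighbours G v)) ≤⟨ length≤∣p∣+∣q∣ _ keys-unique keys-in-range ⟩
      ∣ ⊤ₛ {2} ∣ + ∣ S ∣                ∎)
      where
      open ≤-Reasoning
      keys-in-range : All [ _∈ₛ ⊤ₛ , _∈ₛ S ]′ (map key (neighbours G v))
      keys-in-range = All.map⁺ (All.map (key-in-range ∘ proj₂) neighbours-labelled)

  on-path-labelled : ∀ A {B} F → All (Side F true) A → All (Side F false) B →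
                     ∀ {r} → r ∈ A ++ v ∷ B → r ≢ v → Labelled F r
  on-path-labelled A F A-true B-false r∈ r≢v with ∈-++⁻ A r∈
  ... | inj₁ r∈A = true , All.lookup A-true r∈A
  ... | inj₂ (here r≡v) = contradiction r≡v r≢v
  ... | inj₂ (there r∈B) = false , All.lookup B-false r∈B

  tracking-bound : ∀ A {B} S → TrackingSet G s t S → Path G s t (A ++ v ∷ B) →
                   All (λ c → ∃ λ r → r ∈ A ++ v ∷ B × ReachAvoid G v c r) (neighbours G v) →
                   degree G v ∸ 2 ≤ ∣ S ∣
  tracking-bound A S track (W , U) reach =
    let F₀ , A-true , B-false = path-forest A W U
        labelled-target : ∀ {c} → (∃ λ r → r ∈ A ++ v ∷ _ × ReachAvoid G v c r) →
                          ∃ λ r → Labelled F₀ r × ReachAvoid G v c r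
        labelled-target = λ (r , r∈ , c⇝r) →
          r , on-path-labelled A F₀ A-true B-false r∈ (reach-avoid-end G c⇝r) , c⇝r
        F , F₀⊑F , labelled = grow-all F₀ (All.map labelled-target reach)
        prefix = path-prefix A W U F (All.map F₀⊑F A-true) (All.map F₀⊑F B-false)
    in Counting.degree-bound S F track labelled prefix

exit-from-path : ∀ {n} (G : Graph n) {s t v} A {B} → s ≢ t → Walk G s t (A ++ v ∷ B) →
                 ∃ λ r → r ∈ A ++ v ∷ B × r ≢ v × ∃ λ xs → Walk G v r xs
exit-from-path G {s} {v = v} A s≢t W with s ≟ v
... | yes refl = _ , walk-last G W , s≢t ∘ sym , _ , W
... | no s≢v = s , walk-first G W , s≢v , _ , walk-reverse G (proj₁ (walk-split G A W refl))

neighbours-reach : ∀ {n} (G : Graph n) {v r xs} → ¬ CutVertex G v → r ≢ v → Walk G v r xs →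
                   ¬ ¬ All (λ c → ReachAvoid G v c r) (neighbours G v)
neighbours-reach G {v} {r} ¬cut r≢v W = All.sequenceM _ ¬¬-Monad (All.tabulate λ {c} c∈N ¬reach →
  let e = neighbour-edge G c∈N in
  ¬cut (c , r , (λ { refl → edge-irrefl G e }) , r≢v , (_ , step (edge-sym G e) W) , ¬reach))

corollary1 : ∀ {n} (G : Graph n) (s t : Fin n) → s ≢ t →
    Reduced G s t → ¬ SingleEdge G s t →
    (v : Fin n) → ¬ CutVertex G v →
    (S : Subset n) → TrackingSet G s t S →
    degree G v ∸ 2 ≤ ∣ S ∣
-- Non-cut-vertex gives reachability
-- in G − v only up to double negation, hence the proof by contradiction on the bound.
corollary1 G s t s≢t (¬rule1 , _) _ v ¬cut S track =
  decidable-stable (degree G v ∸ 2 ≤? ∣ S ∣) λ ¬bound →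
    ¬rule1 (inj₁ (v , λ where
      _ path (A , B , refl) →
        let r , r∈ , r≢v , _ , W = exit-from-path G A s≢t (proj₁ path)
        in neighbours-reach G ¬cut r≢v W λ reach →
             ¬bound (Forests.tracking-bound G v s t A S track path
                       (All.map (λ c⇝r → r , r∈ , c⇝r) reach))))
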